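{- Let $\mathcal{T}$ be a plane full binary tree whose leaves, ordered from left to right, are identified with $\mathcal{L}=\{1,\ldots,n\}$. Then for every $\ell\in\{1,\ldots,n\}$, the set $\{1,\ldots,\ell\}$ is a union of at most $1+h_\ell$ sets of the form $D_{\mathcal{T}}(v)$ with $v$ a vertex of $\mathcal{T}$.
   Context: A full binary tree is a finite rooted tree in which every vertex has either exactly two children (a node) or none (a leaf). A plane tree additionally specifies, for each node, which child is left and which is right. Each vertex $v$ is encoded by the $0/1$-word recording the left (0) and right (1) steps on the path from the root to $v$ (the root has the empty word); the left-to-right order of the leaves is the lexicographic order of their words. $D_{\mathcal{T}}(v)$ denotes the set of leaves descending from $v$ (a leaf descends from itself). The height $h_v$ of a vertex $v$ is the number of 1s occurring before the last 0 in its word (and $h_v=0$ if the word contains no 0); $h_\ell$ is the height of the leaf $\ell$. -}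

module Defs where

open import Data.Bool using (Bool; true; false)
open import Data.Nat using (ℕ; zero; suc; _+_)
open import Data.List using (List; []; _∷_; _++_; map; length; lookup)
open import Data.Maybe using (Maybe; just; nothing; maybe)
open import Data.Fin using (Fin)

data Tree : Set where
  leaf : Tree
  node : Tree → Tree → Tree

-- Words: false = 0 = left step, true = 1 = right step.
Word : Set
Word = List Bool

data IsVertex : Tree → Word → Set where
  root  : ∀ {t} → IsVertex t []
  left  : ∀ {l r w} → IsVertex l w → IsVertex (node l r) (false ∷ w)
  right : ∀ {l r w} → IsVertex r w → IsVertex (node l r) (true ∷ w)

leafWords : Tree → List Word
leafWords leaf       = [] ∷ []
leafWords (node l r) = map (false ∷_) (leafWords l) ++ map (true ∷_) (leafWords r)

nLeaves : Tree → ℕ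
nLeaves t = length (leafWords t)

-- The i-th leaf (0-based index i, i.e. leaf number i+1 of the paper).
leafWord : (t : Tree) → Fin (nLeaves t) → Word
leafWord t i = lookup (leafWords t) i

-- Prefix relation on words: v is an ancestor-or-self of w.
data _≼_ : Word → Word → Set where
  []≼ : ∀ {w} → [] ≼ w
  ∷≼  : ∀ {b v w} → v ≼ w → (b ∷ v) ≼ (b ∷ w)

-- Leaf i lies in D_T(v)  iff  the word of v is a prefix of the word of leaf i.
InD : (t : Tree) → Word → Fin (nLeaves t) → Set
InD t v i = v ≼ leafWord t i

-- For a word w = u 0 1^k (last 0 explicitly), returns just u; nothing if w has no 0.
beforeLastZero : Word → Maybe Word
beforeLastZero []      = nothing
beforeLastZero (b ∷ w) with beforeLastZero w
... | just u  = just (b ∷ u)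
... | nothing with b
...   | false = just []
...   | true  = nothing

countOnes : Word → ℕ
countOnes []          = 0
countOnes (true ∷ w)  = suc (countOnes w)
countOnes (false ∷ w) = countOnes w

height : Word → ℕ
height w = maybe countOnes 0 (beforeLastZero w)

{-# OPTIONS --safe #-}
module Submission where

-- If ℓ lies in the left subtree, prefixing its decomposition there with 0
-- gives one for the whole tree, and a leading 0 does not change the height. If ℓ lies in the right
-- subtree, prefix with 1 and add the left child 0, which covers every leaf of the left subtree;
-- a leading 1 raises the height by exactly one provided the word already contains a 0. If it does
-- not, the word of ℓ is 1…1, so ℓ is the last leaf and the root alone suffices.

open import Defs
open import Data.Bool using (true; false)
open import Data.Nat using (suc; _+_; _≤_; _<_; z≤n; s≤s)
open import Data.Nat.Properties
  using (module ≤-Reasoning; ≤-trans; <⇒≤; <⇒≱; m≤m+n; +-monoʳ-≤; +-cancelˡ-≤)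
open import Data.Fin using (Fin; zero; suc; toℕ)
open import Data.Fin.Properties using (toℕ<n)
open import Data.List using (List; []; _∷_; _++_; map; length; lookup; [_])
open import Data.List.Properties using (length-map)
open import Data.List.Relation.Unary.All using (All; []; _∷_)
import Data.List.Relation.Unary.All as All
import Data.List.Relation.Unary.All.Properties as All
open import Data.List.Relation.Unary.Any using (Any; here; there; satisfied)
import Data.List.Relation.Unary.Any as Any
import Data.List.Relation.Unary.Any.Properties as Any
open import Data.Maybe using (just; nothing)
open import Data.Product using (Σ; _×_; _,_)
open import Function.Bundles using (_⇔_; mk⇔)
import Function.Properties.Equivalence as ⇔
open import Function.Base using (_∘_)
open import Relation.Nullary using (¬_; contradiction)
open import Relation.Binary.PropositionalEquality using (_≡_; _≢_; refl; trans; cong; cong₂; subst)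

data ++-View {A : Set} (xs ys : List A) (i : Fin (length (xs ++ ys))) : Set where
  inˡ : (j : Fin (length xs)) → toℕ i ≡ toℕ j → lookup (xs ++ ys) i ≡ lookup xs j → ++-View xs ys i
  inʳ : (k : Fin (length ys)) → toℕ i ≡ length xs + toℕ k → lookup (xs ++ ys) i ≡ lookup ys k →
        ++-View xs ys i

++-view : ∀ {A : Set} (xs ys : List A) (i : Fin (length (xs ++ ys))) → ++-View xs ys i
++-view []       ys i       = inʳ i refl refl
++-view (x ∷ xs) ys zero    = inˡ zero refl refl
++-view (x ∷ xs) ys (suc i) with ++-view xs ys i
... | inˡ j i≡j eq = inˡ (suc j) (cong suc i≡j) eq
... | inʳ k i≡k eq = inʳ k (cong suc i≡k) eq

lookup-map : ∀ {A B : Set} (f : A → B) (xs : List A) (i : Fin (length (map f xs))) →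
  Σ (Fin (length xs)) λ j → toℕ i ≡ toℕ j × lookup (map f xs) i ≡ f (lookup xs j)
lookup-map f (x ∷ xs) zero    = zero , refl , refl
lookup-map f (x ∷ xs) (suc i) with lookup-map f xs i
... | j , i≡j , eq = suc j , cong suc i≡j , eq

data Side (l r : Tree) (i : Fin (nLeaves (node l r))) : Set where
  onLeft  : (j : Fin (nLeaves l)) → toℕ i ≡ toℕ j →
            leafWord (node l r) i ≡ false ∷ leafWord l j → Side l r i
  onRight : (k : Fin (nLeaves r)) → toℕ i ≡ nLeaves l + toℕ k →
            leafWord (node l r) i ≡ true ∷ leafWord r k → Side l r i

side : ∀ l r (i : Fin (nLeaves (node l r))) → Side l r i
side l r i with ++-view (map (false ∷_) (leafWords l)) (map (true ∷_) (leafWords r)) i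
... | inˡ j i≡j eq with lookup-map (false ∷_) (leafWords l) j
...   | j′ , j≡j′ , eq′ = onLeft j′ (trans i≡j j≡j′) (trans eq eq′)
side l r i | inʳ k i≡k eq with lookup-map (true ∷_) (leafWords r) k
...   | k′ , k≡k′ , eq′ =
  onRight k′ (trans i≡k (cong₂ _+_ (length-map (false ∷_) (leafWords l)) k≡k′)) (trans eq eq′)

toℕ<m+n : ∀ {m} (j : Fin m) n → toℕ j < m + n
toℕ<m+n {m} j n = ≤-trans (toℕ<n j) (m≤m+n m n)

any-≼-map-∷ : ∀ b {w} vs → Any (_≼ w) vs ⇔ Any (_≼ (b ∷ w)) (map (b ∷_) vs)
any-≼-map-∷ b vs = mk⇔ (λ p → Any.map⁺ (Any.map ∷≼ p)) (λ p → Any.map ∷≼⁻ (Any.map⁻ p))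
  where
  ∷≼⁻ : ∀ {v w} → (b ∷ v) ≼ (b ∷ w) → v ≼ w
  ∷≼⁻ (∷≼ p) = p

¬any-false∷-≼-true∷ : ∀ {w} vs → ¬ Any (_≼ (true ∷ w)) (map (false ∷_) vs)
¬any-false∷-≼-true∷ vs p with satisfied (Any.map⁻ p)
... | _ , ()

height-false∷ : ∀ w → height (false ∷ w) ≡ height w
height-false∷ w with beforeLastZero w
... | just _  = refl
... | nothing = refl

height-true∷ : ∀ w {u} → beforeLastZero w ≡ just u → height (true ∷ w) ≡ suc (height w)
height-true∷ w lastZero rewrite lastZero = refl

beforeLastZero-false∷ : ∀ w → beforeLastZero (false ∷ w) ≢ nothing
beforeLastZero-false∷ w with beforeLastZero w
... | just _  = λ ()
... | nothing = λ ()

beforeLastZero-true∷ : ∀ w → beforeLastZero (true ∷ w) ≡ nothing → beforeLastZero w ≡ nothing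
beforeLastZero-true∷ w with beforeLastZero w
... | just _  = λ ()
... | nothing = λ _ → refl

Rightmost : (t : Tree) → Fin (nLeaves t) → Set
Rightmost t ℓ = (i : Fin (nLeaves t)) → toℕ i ≤ toℕ ℓ

rightmost-node : ∀ l r {ℓ k} → toℕ ℓ ≡ nLeaves l + toℕ k → Rightmost r k →
                 Rightmost (node l r) ℓ
rightmost-node l r {ℓ} {k} ℓ≡ rightmost i with side l r i
... | onLeft j i≡ _ rewrite ℓ≡ | i≡ = <⇒≤ (toℕ<m+n j (toℕ k))
... | onRight k′ i≡ _ rewrite ℓ≡ | i≡ = +-monoʳ-≤ (nLeaves l) (rightmost k′)

noZero⇒rightmost : ∀ t ℓ → beforeLastZero (leafWord t ℓ) ≡ nothing → Rightmost t ℓ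
noZero⇒rightmost leaf zero _ = λ { zero → z≤n }
noZero⇒rightmost (node l r) ℓ noZero with side l r ℓ
... | onLeft j _ wordℓ =
  contradiction (subst (λ w → beforeLastZero w ≡ nothing) wordℓ noZero)
                (beforeLastZero-false∷ (leafWord l j))
... | onRight k ℓ≡ wordℓ =
  rightmost-node l r ℓ≡ (noZero⇒rightmost r k (beforeLastZero-true∷ (leafWord r k)
    (subst (λ w → beforeLastZero w ≡ nothing) wordℓ noZero)))

Covers : (t : Tree) → Fin (nLeaves t) → List Word → Set
Covers t ℓ vs = (i : Fin (nLeaves t)) → (toℕ i ≤ toℕ ℓ) ⇔ Any (_≼ leafWord t i) vs

covers-left : ∀ l r {ℓ j vs} → toℕ ℓ ≡ toℕ j → Covers l j vs →
              Covers (node l r) ℓ (map (false ∷_) vs)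
covers-left l r {ℓ} {j} {vs} ℓ≡ covers i with side l r i
... | onLeft j′ i≡ wordᵢ rewrite ℓ≡ | i≡ | wordᵢ = ⇔.trans (covers j′) (any-≼-map-∷ false vs)
... | onRight k i≡ wordᵢ rewrite ℓ≡ | i≡ | wordᵢ =
  mk⇔ (λ i≤ℓ → contradiction i≤ℓ (<⇒≱ (toℕ<m+n j (toℕ k))))
      (λ p → contradiction p (¬any-false∷-≼-true∷ vs))

covers-right : ∀ l r {ℓ k vs} → toℕ ℓ ≡ nLeaves l + toℕ k → Covers r k vs →
               Covers (node l r) ℓ ([ false ] ∷ map (true ∷_) vs)
covers-right l r {ℓ} {k} {vs} ℓ≡ covers i with side l r i
... | onLeft j i≡ wordᵢ rewrite ℓ≡ | i≡ | wordᵢ =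
  mk⇔ (λ _ → here (∷≼ []≼)) (λ _ → <⇒≤ (toℕ<m+n j (toℕ k)))
... | onRight k′ i≡ wordᵢ rewrite ℓ≡ | i≡ | wordᵢ =
  ⇔.trans (mk⇔ (+-cancelˡ-≤ (nLeaves l) _ _) (+-monoʳ-≤ (nLeaves l)))
    (⇔.trans (covers k′)
      (⇔.trans (any-≼-map-∷ true vs) (mk⇔ there λ { (here ()) ; (there p) → p })))

Decomposition : (t : Tree) → Fin (nLeaves t) → List Word → Set
Decomposition t ℓ vs = All (IsVertex t) vs × length vs ≤ suc (height (leafWord t ℓ)) × Covers t ℓ vs

root-decomposition : ∀ t ℓ → Rightmost t ℓ → Decomposition t ℓ [ [] ]
root-decomposition t ℓ rightmost =
  root ∷ [] , s≤s z≤n , λ i → mk⇔ (λ _ → here []≼) (λ _ → rightmost i)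

left-decomposition : ∀ l r {ℓ j vs} → toℕ ℓ ≡ toℕ j →
                     leafWord (node l r) ℓ ≡ false ∷ leafWord l j →
                     Decomposition l j vs → Decomposition (node l r) ℓ (map (false ∷_) vs)
left-decomposition l r {ℓ} {j} {vs} ℓ≡ wordℓ (vertices , size , covers) =
  All.map⁺ (All.map left vertices) , size′ , covers-left l r ℓ≡ covers
  where
  open ≤-Reasoning
  size′ : length (map (false ∷_) vs) ≤ suc (height (leafWord (node l r) ℓ))
  size′ = begin
    length (map (false ∷_) vs)           ≡⟨ length-map (false ∷_) vs ⟩
    length vs                            ≤⟨ size ⟩
    suc (height (leafWord l j))          ≡⟨ cong suc (height-false∷ (leafWord l j)) ⟨
    suc (height (false ∷ leafWord l j))  ≡⟨ cong (suc ∘ height) wordℓ ⟨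
    suc (height (leafWord (node l r) ℓ)) ∎

right-decomposition : ∀ l r {ℓ k vs u} → toℕ ℓ ≡ nLeaves l + toℕ k →
                      leafWord (node l r) ℓ ≡ true ∷ leafWord r k →
                      beforeLastZero (leafWord r k) ≡ just u →
                      Decomposition r k vs → Decomposition (node l r) ℓ ([ false ] ∷ map (true ∷_) vs)
right-decomposition l r {ℓ} {k} {vs} ℓ≡ wordℓ lastZero (vertices , size , covers) =
  left root ∷ All.map⁺ (All.map right vertices) , s≤s size′ , covers-right l r ℓ≡ covers
  where
  open ≤-Reasoning
  size′ : length (map (true ∷_) vs) ≤ height (leafWord (node l r) ℓ)
  size′ = begin
    length (map (true ∷_) vs)        ≡⟨ length-map (true ∷_) vs ⟩
    length vs                        ≤⟨ size ⟩
    suc (height (leafWord r k))      ≡⟨ height-true∷ (leafWord r k) lastZero ⟨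
    height (true ∷ leafWord r k)     ≡⟨ cong height wordℓ ⟨
    height (leafWord (node l r) ℓ)   ∎

theorem4p4 : (t : Tree) (ℓ : Fin (nLeaves t)) →
    Σ (List Word) λ vs →
      All (IsVertex t) vs ×
      length vs ≤ suc (height (leafWord t ℓ)) ×
      ((i : Fin (nLeaves t)) → (toℕ i ≤ toℕ ℓ) ⇔ Any (λ v → InD t v i) vs)
theorem4p4 leaf zero = [ [] ] , root-decomposition leaf zero λ { zero → z≤n }
theorem4p4 (node l r) ℓ with side l r ℓ
... | onLeft j ℓ≡ wordℓ =
  let vs , decomposition = theorem4p4 l j
  in map (false ∷_) vs , left-decomposition l r ℓ≡ wordℓ decomposition
... | onRight k ℓ≡ wordℓ with beforeLastZero (leafWord r k) in lastZero
...   | nothing =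
  [ [] ] , root-decomposition (node l r) ℓ (rightmost-node l r ℓ≡ (noZero⇒rightmost r k lastZero))
...   | just _ =
  let vs , decomposition = theorem4p4 r k
  in [ false ] ∷ map (true ∷_) vs , right-decomposition l r ℓ≡ wordℓ lastZero decomposition
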